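{- Let $M$ be an abelian group, $P \subseteq M$, and $B_1, B_2 \subseteq M$ structuring elements. Then: (a) if $B_1 \subseteq_{S,P,+} B_2$, then $B_1 \subseteq_{WS,P,+} B_2$; (b) if $B_1 \subseteq_{S,P,- } B_2$, then $B_1 \subseteq_{WS,P,- } B_2$.
   Context: A structuring element is a finite set $B$ with $0 \in B \subseteq M$. For $x \in P$, $B(x;P,+) = \{ b \in B : x + b \in P\}$, $B(x;P,-) = \{ b \in B : x - b \in P\}$. $A + v = \{a+v : a \in A\}$. $B_1 \subseteq_{S,P,+} B_2$: $B_1 \subseteq B_2$ and for every $x \in P$, $b_2 \in B_2(x;P,+)$ there is $b_1 \in B_1(x;P,+)$ with $B_1 + (b_2 - b_1) \subseteq B_2$. $B_1 \subseteq_{S,P,- } B_2$: $B_1 \subseteq B_2$ and for every $x \in P$, $b_2 \in B_2(x;P,-)$ there is $b_1 \in B_1(x;P,-)$ with $B_1 + (b_2 - b_1) \subseteq B_2$. $B_1 \subseteq_{WS,P,+} B_2$: $B_1 \subseteq B_2$ and for every $x \in P$ and $b_2 \in B_2(x;P,+)$ there exists $b_1 \in B_1(x;P,+)$ such that for every $b_1' \in B_1(x + b_1;P,-)$ there is $b_2' \in B_2$ with $x + b_2 - b_2' = x + b_1 - b_1'$. $B_1 \subseteq_{WS,P,- } B_2$: $B_1 \subseteq B_2$ and for every $x \in P$ and $b_2 \in B_2(x;P,-)$ there exists $b_1 \in B_1(x;P,-)$ such that for every $b_1' \in B_1(x - b_1;P,+)$ there is $b_2' \in B_2$ with $x - b_2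 + b_2' = x - b_1 + b_1'$. -}

module Defs where

open import Level using (Level; _⊔_; suc)
open import Algebra.Bundles using (AbelianGroup)
open import Data.Product using (Σ; _×_; ∃; _,_)
open import Data.List using (List)
open import Data.List.Relation.Unary.Any using (Any)

module _ {c ℓ : Level} (M : AbelianGroup c ℓ) where
  open AbelianGroup M renaming (Carrier to A)

  record Subset (p : Level) : Set (c ⊔ ℓ ⊔ suc p) where
    field
      mem     : A → Set p
      respect : ∀ {x y} → x ≈ y → mem x → mem y
  open Subset public

  record StructuringElement (p : Level) : Set (c ⊔ ℓ ⊔ suc p) where
    field
      set     : Subset p
      finite  : Σ (List A) λ xs → ∀ b → mem set b → Any (b ≈_) xs
      has-zero : mem set ε
  open StructuringElement public

  module _ {p q r : Level} (P : Subset p) (B₁ : StructuringElement q) (B₂ : StructuringElement r) where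
    private
      _∈B₁ = mem (set B₁)
      _∈B₂ = mem (set B₂)
      _∈P  = mem P

    Incl : Set (c ⊔ q ⊔ r)
    Incl = ∀ b → b ∈B₁ → b ∈B₂

    ShiftIncl : A → Set (c ⊔ q ⊔ r)
    ShiftIncl v = ∀ a → a ∈B₁ → (a ∙ v) ∈B₂

    SubS+ : Set (c ⊔ p ⊔ q ⊔ r)
    SubS+ = Incl × (∀ x → x ∈P → ∀ b₂ → b₂ ∈B₂ → (x ∙ b₂) ∈P →
              Σ A λ b₁ → b₁ ∈B₁ × (x ∙ b₁) ∈P × ShiftIncl (b₂ - b₁))

    SubS- : Set (c ⊔ p ⊔ q ⊔ r)
    SubS- = Incl × (∀ x → x ∈P → ∀ b₂ → b₂ ∈B₂ → (x - b₂) ∈P →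
              Σ A λ b₁ → b₁ ∈B₁ × (x - b₁) ∈P × ShiftIncl (b₂ - b₁))

    SubWS+ : Set (c ⊔ ℓ ⊔ p ⊔ q ⊔ r)
    SubWS+ = Incl × (∀ x → x ∈P → ∀ b₂ → b₂ ∈B₂ → (x ∙ b₂) ∈P →
              Σ A λ b₁ → b₁ ∈B₁ × (x ∙ b₁) ∈P ×
                (∀ b₁' → b₁' ∈B₁ → ((x ∙ b₁) - b₁') ∈P →
                   Σ A λ b₂' → b₂' ∈B₂ × ((x ∙ b₂) - b₂') ≈ ((x ∙ b₁) - b₁')))

    SubWS- : Set (c ⊔ ℓ ⊔ p ⊔ q ⊔ r)
    SubWS- = Incl × (∀ x → x ∈P → ∀ b₂ → b₂ ∈B₂ → (x - b₂) ∈P →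
              Σ A λ b₁ → b₁ ∈B₁ × (x - b₁) ∈P ×
                (∀ b₁' → b₁' ∈B₁ → ((x - b₁) ∙ b₁') ∈P →
                   Σ A λ b₂' → b₂' ∈B₂ × ((x - b₂) ∙ b₂') ≈ ((x - b₁) ∙ b₁')))

-- In both cases the strong witness b₁ already works: for any b₁' ∈ B₁ take
-- b₂' = b₁' + (b₂ − b₁), which lies in B₂ because B₁ + (b₂ − b₁) ⊆ B₂, and the
-- translation by b₂ − b₁ cancels in the required equation.
module Submission where

open import Defs
open import Level using (Level)
open import Algebra.Bundles using (AbelianGroup)
open import Data.Product using (_×_; _,_)
import Algebra.Properties.AbelianGroup as AbelianGroupProperties
import Algebra.Properties.CommutativeSemigroup as CommutativeSemigroupProperties
import Relation.Binary.Reasoning.Setoid as SetoidReasoning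

module TranslationCancellation {c ℓ : Level} (M : AbelianGroup c ℓ) where
  open AbelianGroup M
  open AbelianGroupProperties M using (xyx⁻¹≈y; ⁻¹-∙-comm; ⁻¹-involutive)
  open CommutativeSemigroupProperties commutativeSemigroup using (interchange)
  open SetoidReasoning setoid

  ∙-cancel-inverse-pair : ∀ a b v → (a ∙ v) ∙ (b ∙ v ⁻¹) ≈ a ∙ b
  ∙-cancel-inverse-pair a b v = begin
    (a ∙ v) ∙ (b ∙ v ⁻¹) ≈⟨ interchange a v b (v ⁻¹) ⟩
    (a ∙ b) ∙ (v ∙ v ⁻¹) ≈⟨ ∙-congˡ (inverseʳ v) ⟩
    (a ∙ b) ∙ ε          ≈⟨ identityʳ (a ∙ b) ⟩
    a ∙ b                ∎

  ∙-[-]-cancel : ∀ b₁ b₂ → b₁ ∙ (b₂ - b₁) ≈ b₂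
  ∙-[-]-cancel b₁ b₂ = trans (sym (assoc b₁ b₂ (b₁ ⁻¹))) (xyx⁻¹≈y b₁ b₂)

  -‿translate : ∀ a b v → (a ∙ v) - (b ∙ v) ≈ a - b
  -‿translate a b v = begin
    (a ∙ v) ∙ (b ∙ v) ⁻¹    ≈⟨ ∙-congˡ (sym (⁻¹-∙-comm b v)) ⟩
    (a ∙ v) ∙ (b ⁻¹ ∙ v ⁻¹) ≈⟨ ∙-cancel-inverse-pair a (b ⁻¹) v ⟩
    a - b                   ∎

  ∙-translate : ∀ a b v → (a - v) ∙ (b ∙ v) ≈ a ∙ b
  ∙-translate a b v = begin
    (a ∙ v ⁻¹) ∙ (b ∙ v)       ≈⟨ ∙-congˡ (∙-congˡ (sym (⁻¹-involutive v))) ⟩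
    (a ∙ v ⁻¹) ∙ (b ∙ v ⁻¹ ⁻¹) ≈⟨ ∙-cancel-inverse-pair a b (v ⁻¹) ⟩
    a ∙ b                      ∎

  +-shift-witness : ∀ x b₁ b₂ b₁' → (x ∙ b₂) - (b₁' ∙ (b₂ - b₁)) ≈ (x ∙ b₁) - b₁'
  +-shift-witness x b₁ b₂ b₁' = begin
    (x ∙ b₂) - (b₁' ∙ v)        ≈⟨ ∙-congʳ (∙-congˡ (sym (∙-[-]-cancel b₁ b₂))) ⟩
    (x ∙ (b₁ ∙ v)) - (b₁' ∙ v)  ≈⟨ ∙-congʳ (sym (assoc x b₁ v)) ⟩
    ((x ∙ b₁) ∙ v) - (b₁' ∙ v)  ≈⟨ -‿translate (x ∙ b₁) b₁' v ⟩
    (x ∙ b₁) - b₁'              ∎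
    where v = b₂ - b₁

  -‿shift-witness : ∀ x b₁ b₂ b₁' → (x - b₂) ∙ (b₁' ∙ (b₂ - b₁)) ≈ (x - b₁) ∙ b₁'
  -‿shift-witness x b₁ b₂ b₁' = begin
    (x - b₂) ∙ (b₁' ∙ v)             ≈⟨ ∙-congʳ (∙-congˡ (⁻¹-cong (sym (∙-[-]-cancel b₁ b₂)))) ⟩
    (x - (b₁ ∙ v)) ∙ (b₁' ∙ v)       ≈⟨ ∙-congʳ (∙-congˡ (sym (⁻¹-∙-comm b₁ v))) ⟩
    (x ∙ (b₁ ⁻¹ ∙ v ⁻¹)) ∙ (b₁' ∙ v) ≈⟨ ∙-congʳ (sym (assoc x (b₁ ⁻¹) (v ⁻¹))) ⟩
    ((x - b₁) - v) ∙ (b₁' ∙ v)       ≈⟨ ∙-translate (x - b₁) b₁' v ⟩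
    (x - b₁) ∙ b₁'                   ∎
    where v = b₂ - b₁

module _ {c ℓ p q r : Level} (M : AbelianGroup c ℓ) (P : Subset M p)
         (B₁ : StructuringElement M q) (B₂ : StructuringElement M r) where
  open TranslationCancellation M using (+-shift-witness; -‿shift-witness)

  SubS+⇒SubWS+ : SubS+ M P B₁ B₂ → SubWS+ M P B₁ B₂
  SubS+⇒SubWS+ (B₁⊆B₂ , strong) = B₁⊆B₂ , λ x x∈P b₂ b₂∈B₂ x+b₂∈P →
    let (b₁ , b₁∈B₁ , x+b₁∈P , shift⊆B₂) = strong x x∈P b₂ b₂∈B₂ x+b₂∈P in
    b₁ , b₁∈B₁ , x+b₁∈P , λ b₁' b₁'∈B₁ _ →
      _ , shift⊆B₂ b₁' b₁'∈B₁ , +-shift-witness x b₁ b₂ b₁'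

  SubS-⇒SubWS- : SubS- M P B₁ B₂ → SubWS- M P B₁ B₂
  SubS-⇒SubWS- (B₁⊆B₂ , strong) = B₁⊆B₂ , λ x x∈P b₂ b₂∈B₂ x-b₂∈P →
    let (b₁ , b₁∈B₁ , x-b₁∈P , shift⊆B₂) = strong x x∈P b₂ b₂∈B₂ x-b₂∈P in
    b₁ , b₁∈B₁ , x-b₁∈P , λ b₁' b₁'∈B₁ _ →
      _ , shift⊆B₂ b₁' b₁'∈B₁ , -‿shift-witness x b₁ b₂ b₁'

proposition5 : {c ℓ p q r : Level} (M : AbelianGroup c ℓ) (P : Subset M p)
    (B₁ : StructuringElement M q) (B₂ : StructuringElement M r) →
    (SubS+ M P B₁ B₂ → SubWS+ M P B₁ B₂) × (SubS- M P B₁ B₂ → SubWS- M P B₁ B₂)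
proposition5 M P B₁ B₂ = SubS+⇒SubWS+ M P B₁ B₂ , SubS-⇒SubWS- M P B₁ B₂
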